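{- Let $a_n$ denote the number of trees with distinguished children having $n$ nodes, and let $A(z)=\sum_{n\ge1}a_nz^n$. Then $A$ satisfies $$A(z)=z+\frac{zA(z)}{(1-A(z))^2},$$ and for every $n\ge1$, $$a_n=\frac1n\sum_{k=1}^{n}\binom{n}{k}\binom{2n-2-k}{k-1}.$$
   Context: An ordered (plane) tree consists of a root together with an ordered sequence of $m\ge 0$ subtrees, each of which is recursively an ordered tree. A tree with distinguished children is an ordered tree in which, for every node that has at least one child, exactly one of its children is designated as distinguished; two such trees are different if their underlying ordered trees differ or their choices of distinguished children differ. Size is measured by the number of nodes. Binomial coefficients $\binom{a}{b}$ with $b<0$ are $0$, and $\binom{a}{0}=1$ for every integer $a$. -}

module Defs where

open import Data.Nat using (ℕ; zero; suc; _+_; _*_; _∸_)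
open import Data.Nat.Combinatorics using (_C_)
open import Data.Fin using (Fin)
open import Data.Unit using (⊤)
open import Data.Vec using (Vec; []; _∷_)
open import Data.Product using (Σ)
open import Data.Integer as ℤ using (ℤ; +_)
open import Relation.Binary.PropositionalEquality using (_≡_)

-- Trees with distinguished children.
-- A node has an ordered sequence of m ≥ 0 children (a Vec of length m),
-- and, if m ≥ 1, a choice of exactly one distinguished child (Fin m).

Choice : ℕ → Set
Choice zero    = ⊤
Choice (suc m) = Fin (suc m)

data DTree : Set where
  node : (m : ℕ) → Vec DTree m → Choice m → DTree

mutual
  size : DTree → ℕ
  size (node m cs _) = suc (sizes cs)

  sizes : ∀ {m} → Vec DTree m → ℕ
  sizes []       = 0
  sizes (t ∷ ts) = size t + sizes ts

TreesOfSize : ℕ → Set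
TreesOfSize n = Σ DTree (λ t → size t ≡ n)

FPS : Set
FPS = ℕ → ℤ

sumℤ : ℕ → (ℕ → ℤ) → ℤ
sumℤ zero    f = f 0
sumℤ (suc n) f = sumℤ n f ℤ.+ f (suc n)

_⊕_ : FPS → FPS → FPS
(f ⊕ g) n = f n ℤ.+ g n

_⊖_ : FPS → FPS → FPS
(f ⊖ g) n = f n ℤ.- g n

_⊛_ : FPS → FPS → FPS
(f ⊛ g) n = sumℤ n (λ k → f k ℤ.* g (n ∸ k))

infixl 6 _⊕_ _⊖_
infixl 7 _⊛_

𝟙 : FPS
𝟙 zero    = + 1
𝟙 (suc _) = + 0

𝕫 : FPS
𝕫 1 = + 1
𝕫 _ = + 0

infix 4 _≋_
_≋_ : FPS → FPS → Set
f ≋ g = ∀ n → f n ≡ g n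

genFun : (ℕ → ℕ) → FPS
genFun a zero    = + 0
genFun a (suc n) = + a (suc n)

sum1to : ℕ → (ℕ → ℕ) → ℕ
sum1to zero    f = 0
sum1to (suc n) f = sum1to n f + f (suc n)

-- Σ_{k=1}^{n} C(n,k) C(2n-2-k, k-1).  Truncated subtraction is harmless:
-- k ≥ 1 so k-1 is exact, and 2n-2-k < 0 only for n = k = 1, where the
-- convention C(-1,0) = 1 agrees with 0 C 0 = 1.
formulaSum : ℕ → ℕ
formulaSum n = sum1to n (λ k → (n C k) * ((2 * n ∸ 2 ∸ k) C (k ∸ 1)))

-- A tree with distinguished children is a root whose m subtrees come with φ m = max(m, 1)
-- choices, and φ(u) = Σ φ m uᵐ = 1 + u/(1-u)².  Deleting the root of the first tree of a
-- forest gives the Łukasiewicz recursion for forests, and the hitting-time theorem of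
-- Lagrange inversion turns it into n aₙ = [u^(n-1)] φ(u)ⁿ.  Expanding
-- φⁿ = Σᵢ C(n,i) (u/(1-u)²)ⁱ, where [uʲ] (u/(1-u)²)ⁱ = C(j+i-1, 2i-1), and reversing the
-- sum gives the formula.  For the functional equation, a tree with more than one node is a
-- root, its distinguished subtree and the forests to its left and right; so A = z + z A F²,
-- where the forest series F = 1 + A F is the unique inverse of 1 - A.

module Submission where

open import Defs
open import Data.Nat using (ℕ; zero; suc; _+_; _*_; _∸_; _≤_; _<_; z≤n; s≤s; NonZero)
open import Data.Nat.Properties
open import Data.Nat.Combinatorics using (_C_; nC1≡n; nCn≡1; nCk+nC[k+1]≡[n+1]C[k+1]; k>n⇒nCk≡0; nCk≡nC[n∸k])
open import Data.Nat.Induction using (<-rec)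
open import Data.Nat.Tactic.RingSolver using (solve-∀)
import Algebra.Properties.CommutativeSemigroup as CommSemigroupProperties
open CommSemigroupProperties +-commutativeSemigroup using () renaming (interchange to +-interchange)
open CommSemigroupProperties *-commutativeSemigroup using () renaming (x∙yz≈y∙xz to *-left-comm)
open import Data.Fin using (Fin; fromℕ; _↑ˡ_)
open import Data.Fin.Properties using (+↔⊎; *↔×; 1↔⊤)
open import Data.Fin.Permutation using (↔⇒≡)
open import Data.Vec using (Vec; []; _∷_; _++_; _∷ʳ_; take; drop)
open import Data.Vec.Properties using (take++drop≡id; ++-injectiveˡ; ++-injectiveʳ)
open import Data.Empty using (⊥-elim)
open import Data.Unit using (tt)
open import Data.Product using (Σ; _×_; _,_)
open import Data.Product.Algebra using (×-cong)
open import Data.Sum using (_⊎_; inj₁; inj₂)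
open import Data.Sum.Algebra using (⊎-cong)
open import Function using (_∘_; id; const)
open import Function.Bundles using (_↔_; Inverse; mk↔ₛ′)
open import Function.Properties.Inverse using (↔-refl; ↔-sym; ↔-trans)
open import Relation.Nullary using (¬_)
open import Relation.Binary.PropositionalEquality

sumUpTo : ℕ → (ℕ → ℕ) → ℕ
sumUpTo zero    f = f 0
sumUpTo (suc n) f = f 0 + sumUpTo n (f ∘ suc)

sumUpTo-cong : ∀ n {f g : ℕ → ℕ} → (∀ k → k ≤ n → f k ≡ g k) → sumUpTo n f ≡ sumUpTo n g
sumUpTo-cong zero    f≡g = f≡g 0 z≤n
sumUpTo-cong (suc n) f≡g = cong₂ _+_ (f≡g 0 z≤n) (sumUpTo-cong n (λ k k≤n → f≡g (suc k) (s≤s k≤n)))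

sumUpTo-zero : ∀ n {f : ℕ → ℕ} → (∀ k → f k ≡ 0) → sumUpTo n f ≡ 0
sumUpTo-zero zero    f≡0 = f≡0 0
sumUpTo-zero (suc n) f≡0 = cong₂ _+_ (f≡0 0) (sumUpTo-zero n (f≡0 ∘ suc))

sumUpTo-distrib-+ : ∀ n (f g : ℕ → ℕ) → sumUpTo n (λ k → f k + g k) ≡ sumUpTo n f + sumUpTo n g
sumUpTo-distrib-+ zero    f g = refl
sumUpTo-distrib-+ (suc n) f g = begin
  f 0 + g 0 + sumUpTo n (λ k → f (suc k) + g (suc k))
    ≡⟨ cong (f 0 + g 0 +_) (sumUpTo-distrib-+ n (f ∘ suc) (g ∘ suc)) ⟩
  f 0 + g 0 + (sumUpTo n (f ∘ suc) + sumUpTo n (g ∘ suc))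
    ≡⟨ +-interchange (f 0) (g 0) _ _ ⟩
  f 0 + sumUpTo n (f ∘ suc) + (g 0 + sumUpTo n (g ∘ suc)) ∎
  where open ≡-Reasoning

*-distribˡ-sumUpTo : ∀ n c (f : ℕ → ℕ) → c * sumUpTo n f ≡ sumUpTo n (λ k → c * f k)
*-distribˡ-sumUpTo zero    c f = refl
*-distribˡ-sumUpTo (suc n) c f =
  trans (*-distribˡ-+ c (f 0) _) (cong (c * f 0 +_) (*-distribˡ-sumUpTo n c (f ∘ suc)))

sumUpTo-suc : ∀ n (f : ℕ → ℕ) → sumUpTo (suc n) f ≡ sumUpTo n f + f (suc n)
sumUpTo-suc zero    f = refl
sumUpTo-suc (suc n) f =
  trans (cong (f 0 +_) (sumUpTo-suc n (f ∘ suc))) (sym (+-assoc (f 0) _ _))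

sumUpTo-reverse : ∀ n (f : ℕ → ℕ) → sumUpTo n f ≡ sumUpTo n (λ k → f (n ∸ k))
sumUpTo-reverse zero    f = refl
sumUpTo-reverse (suc n) f = begin
  sumUpTo (suc n) f                          ≡⟨ sumUpTo-suc n f ⟩
  sumUpTo n f + f (suc n)                    ≡⟨ cong (_+ f (suc n)) (sumUpTo-reverse n f) ⟩
  sumUpTo n (λ k → f (n ∸ k)) + f (suc n)    ≡⟨ +-comm _ (f (suc n)) ⟩
  f (suc n) + sumUpTo n (λ k → f (n ∸ k))    ∎
  where open ≡-Reasoning

sumUpTo-truncate : ∀ {m n} (f : ℕ → ℕ) → m ≤ n → (∀ k → m < k → f k ≡ 0) →
                   sumUpTo n f ≡ sumUpTo m f
sumUpTo-truncate {zero}  {zero}  f _ _ = refl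
sumUpTo-truncate {zero}  {suc n} f _ f≡0 =
  trans (cong (f 0 +_) (sumUpTo-zero n (λ k → f≡0 (suc k) (s≤s z≤n)))) (+-identityʳ (f 0))
sumUpTo-truncate {suc m} {suc n} f (s≤s m≤n) f≡0 =
  cong (f 0 +_) (sumUpTo-truncate (f ∘ suc) m≤n (λ k m<k → f≡0 (suc k) (s≤s m<k)))

sumUpTo-comm : ∀ m n (f : ℕ → ℕ → ℕ) →
               sumUpTo m (λ i → sumUpTo n (f i)) ≡ sumUpTo n (λ j → sumUpTo m (λ i → f i j))
sumUpTo-comm zero    n f = refl
sumUpTo-comm (suc m) n f = trans (cong (sumUpTo n (f 0) +_) (sumUpTo-comm m n (f ∘ suc)))
  (sym (sumUpTo-distrib-+ n (f 0) (λ j → sumUpTo m (λ i → f (suc i) j))))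

infixl 7 _⋆_

_⋆_ : (ℕ → ℕ) → (ℕ → ℕ) → ℕ → ℕ
(f ⋆ g) zero    = f 0 * g 0
(f ⋆ g) (suc n) = f 0 * g (suc n) + (f ∘ suc ⋆ g) n

⋆-sumUpTo : ∀ f g n → (f ⋆ g) n ≡ sumUpTo n (λ k → f k * g (n ∸ k))
⋆-sumUpTo f g zero    = refl
⋆-sumUpTo f g (suc n) = cong (f 0 * g (suc n) +_) (⋆-sumUpTo (f ∘ suc) g n)

⋆-cong : ∀ {f f′ g g′} → f ≗ f′ → g ≗ g′ → f ⋆ g ≗ f′ ⋆ g′
⋆-cong {f} {f′} {g} {g′} f≗f′ g≗g′ n = begin
  (f ⋆ g) n                            ≡⟨ ⋆-sumUpTo f g n ⟩
  sumUpTo n (λ k → f k * g (n ∸ k))    ≡⟨ sumUpTo-cong n (λ k _ → cong₂ _*_ (f≗f′ k) (g≗g′ (n ∸ k))) ⟩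
  sumUpTo n (λ k → f′ k * g′ (n ∸ k))  ≡⟨ sym (⋆-sumUpTo f′ g′ n) ⟩
  (f′ ⋆ g′) n                          ∎
  where open ≡-Reasoning

⋆-comm : ∀ f g → f ⋆ g ≗ g ⋆ f
⋆-comm f g n = begin
  (f ⋆ g) n                                        ≡⟨ ⋆-sumUpTo f g n ⟩
  sumUpTo n (λ k → f k * g (n ∸ k))                ≡⟨ sumUpTo-reverse n _ ⟩
  sumUpTo n (λ k → f (n ∸ k) * g (n ∸ (n ∸ k)))    ≡⟨ sumUpTo-cong n swap ⟩
  sumUpTo n (λ k → g k * f (n ∸ k))                ≡⟨ sym (⋆-sumUpTo g f n) ⟩
  (g ⋆ f) n                                        ∎
  where
  open ≡-Reasoning
  swap : ∀ k → k ≤ n → f (n ∸ k) * g (n ∸ (n ∸ k)) ≡ g k * f (n ∸ k)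
  swap k k≤n = trans (cong (λ i → f (n ∸ k) * g i) (m∸[m∸n]≡n k≤n)) (*-comm (f (n ∸ k)) (g k))

⋆-distribʳ-+ : ∀ f f′ g → (λ k → f k + f′ k) ⋆ g ≗ λ n → (f ⋆ g) n + (f′ ⋆ g) n
⋆-distribʳ-+ f f′ g n = begin
  ((λ k → f k + f′ k) ⋆ g) n                                    ≡⟨ ⋆-sumUpTo _ g n ⟩
  sumUpTo n (λ k → (f k + f′ k) * g (n ∸ k))                    ≡⟨ sumUpTo-cong n (λ k _ → *-distribʳ-+ (g (n ∸ k)) (f k) (f′ k)) ⟩
  sumUpTo n (λ k → f k * g (n ∸ k) + f′ k * g (n ∸ k))          ≡⟨ sumUpTo-distrib-+ n _ _ ⟩
  sumUpTo n (λ k → f k * g (n ∸ k)) + sumUpTo n (λ k → f′ k * g (n ∸ k))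
    ≡⟨ sym (cong₂ _+_ (⋆-sumUpTo f g n) (⋆-sumUpTo f′ g n)) ⟩
  (f ⋆ g) n + (f′ ⋆ g) n                                        ∎
  where open ≡-Reasoning

*-distribˡ-⋆ : ∀ c f g → (λ k → c * f k) ⋆ g ≗ λ n → c * (f ⋆ g) n
*-distribˡ-⋆ c f g n = begin
  ((λ k → c * f k) ⋆ g) n                      ≡⟨ ⋆-sumUpTo _ g n ⟩
  sumUpTo n (λ k → c * f k * g (n ∸ k))        ≡⟨ sumUpTo-cong n (λ k _ → *-assoc c (f k) (g (n ∸ k))) ⟩
  sumUpTo n (λ k → c * (f k * g (n ∸ k)))      ≡⟨ sym (*-distribˡ-sumUpTo n c _) ⟩
  c * sumUpTo n (λ k → f k * g (n ∸ k))        ≡⟨ cong (c *_) (sym (⋆-sumUpTo f g n)) ⟩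
  c * (f ⋆ g) n                                ∎
  where open ≡-Reasoning

*-distribʳ-⋆ : ∀ c f g → f ⋆ (λ k → c * g k) ≗ λ n → c * (f ⋆ g) n
*-distribʳ-⋆ c f g n = begin
  (f ⋆ (λ k → c * g k)) n   ≡⟨ ⋆-comm f _ n ⟩
  ((λ k → c * g k) ⋆ f) n   ≡⟨ *-distribˡ-⋆ c g f n ⟩
  c * (g ⋆ f) n             ≡⟨ cong (c *_) (⋆-comm g f n) ⟩
  c * (f ⋆ g) n             ∎
  where open ≡-Reasoning

⋆-assoc : ∀ f g h → (f ⋆ g) ⋆ h ≗ f ⋆ (g ⋆ h)
⋆-assoc f g h zero    = *-assoc (f 0) (g 0) (h 0)
⋆-assoc f g h (suc n) = begin
  f 0 * g 0 * h (suc n) + ((f ⋆ g) ∘ suc ⋆ h) n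
    ≡⟨ cong (f 0 * g 0 * h (suc n) +_) (⋆-distribʳ-+ (λ k → f 0 * g (suc k)) (f ∘ suc ⋆ g) h n) ⟩
  f 0 * g 0 * h (suc n) + (((λ k → f 0 * g (suc k)) ⋆ h) n + (f ∘ suc ⋆ g ⋆ h) n)
    ≡⟨ cong₂ (λ x y → f 0 * g 0 * h (suc n) + (x + y)) (*-distribˡ-⋆ (f 0) (g ∘ suc) h n) (⋆-assoc (f ∘ suc) g h n) ⟩
  f 0 * g 0 * h (suc n) + (f 0 * (g ∘ suc ⋆ h) n + (f ∘ suc ⋆ (g ⋆ h)) n)
    ≡⟨ regroup (f 0) (g 0) (h (suc n)) _ _ ⟩
  f 0 * (g 0 * h (suc n) + (g ∘ suc ⋆ h) n) + (f ∘ suc ⋆ (g ⋆ h)) n ∎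
  where
  open ≡-Reasoning
  regroup : ∀ a b c d e → a * b * c + (a * d + e) ≡ a * (b * c + d) + e
  regroup = solve-∀

⋆-exchange : ∀ f g h → f ⋆ (g ⋆ h) ≗ g ⋆ (f ⋆ h)
⋆-exchange f g h n = begin
  (f ⋆ (g ⋆ h)) n   ≡⟨ sym (⋆-assoc f g h n) ⟩
  (f ⋆ g ⋆ h) n     ≡⟨ ⋆-cong (⋆-comm f g) (λ _ → refl) n ⟩
  (g ⋆ f ⋆ h) n     ≡⟨ ⋆-assoc g f h n ⟩
  (g ⋆ (f ⋆ h)) n   ∎
  where open ≡-Reasoning

δ₀ : ℕ → ℕ
δ₀ zero    = 1
δ₀ (suc _) = 0

⋆-zeroˡ : ∀ g → const 0 ⋆ g ≗ const 0
⋆-zeroˡ g zero    = refl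
⋆-zeroˡ g (suc n) = ⋆-zeroˡ g n

⋆-zeroʳ : ∀ f → f ⋆ const 0 ≗ const 0
⋆-zeroʳ f n = trans (⋆-comm f (const 0) n) (⋆-zeroˡ f n)

⋆-identityˡ : ∀ g → δ₀ ⋆ g ≗ g
⋆-identityˡ g zero    = +-identityʳ (g 0)
⋆-identityˡ g (suc n) = trans (cong₂ _+_ (+-identityʳ (g (suc n))) (⋆-zeroˡ g n)) (+-identityʳ (g (suc n)))

⋆-sumUpToʳ : ∀ m f (g : ℕ → ℕ → ℕ) → f ⋆ (λ j → sumUpTo m (λ i → g i j)) ≗ λ n → sumUpTo m (λ i → (f ⋆ g i) n)
⋆-sumUpToʳ m f g n = begin
  (f ⋆ (λ j → sumUpTo m (λ i → g i j))) n             ≡⟨ ⋆-sumUpTo f _ n ⟩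
  sumUpTo n (λ k → f k * sumUpTo m (λ i → g i (n ∸ k))) ≡⟨ sumUpTo-cong n (λ k _ → *-distribˡ-sumUpTo m (f k) _) ⟩
  sumUpTo n (λ k → sumUpTo m (λ i → f k * g i (n ∸ k))) ≡⟨ sumUpTo-comm n m _ ⟩
  sumUpTo m (λ i → sumUpTo n (λ k → f k * g i (n ∸ k))) ≡⟨ sumUpTo-cong m (λ i _ → sym (⋆-sumUpTo f (g i) n)) ⟩
  sumUpTo m (λ i → (f ⋆ g i) n)                         ∎
  where open ≡-Reasoning

-- θ is u d/du on coefficient sequences.
θ : (ℕ → ℕ) → ℕ → ℕ
θ f k = k * f k

θ-⋆ : ∀ f g → θ (f ⋆ g) ≗ λ n → (θ f ⋆ g) n + (f ⋆ θ g) n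
θ-⋆ f g n = begin
  n * (f ⋆ g) n                                           ≡⟨ cong (n *_) (⋆-sumUpTo f g n) ⟩
  n * sumUpTo n (λ k → f k * g (n ∸ k))                   ≡⟨ *-distribˡ-sumUpTo n n _ ⟩
  sumUpTo n (λ k → n * (f k * g (n ∸ k)))                 ≡⟨ sumUpTo-cong n split ⟩
  sumUpTo n (λ k → θ f k * g (n ∸ k) + f k * θ g (n ∸ k)) ≡⟨ sumUpTo-distrib-+ n _ _ ⟩
  sumUpTo n (λ k → θ f k * g (n ∸ k)) + sumUpTo n (λ k → f k * θ g (n ∸ k))
    ≡⟨ sym (cong₂ _+_ (⋆-sumUpTo (θ f) g n) (⋆-sumUpTo f (θ g) n)) ⟩
  (θ f ⋆ g) n + (f ⋆ θ g) n                               ∎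
  where
  open ≡-Reasoning
  distrib : ∀ a b c d → (a + b) * (c * d) ≡ a * c * d + c * (b * d)
  distrib = solve-∀
  split : ∀ k → k ≤ n → n * (f k * g (n ∸ k)) ≡ θ f k * g (n ∸ k) + f k * θ g (n ∸ k)
  split k k≤n = trans (cong (λ x → x * (f k * g (n ∸ k))) (sym (m+[n∸m]≡n k≤n))) (distrib k (n ∸ k) (f k) (g (n ∸ k)))

-- φ m = |Choice m|; these are the coefficients of φ(u) = 1 + u/(1-u)².
φ : ℕ → ℕ
φ zero    = 1
φ (suc m) = suc m

φ^ : ℕ → ℕ → ℕ
φ^ zero    = δ₀
φ^ (suc n) = φ ⋆ φ^ n

forests : ℕ → ℕ → ℕ
forests zero    k       = δ₀ k
forests (suc n) zero    = 0
forests (suc n) (suc k) = sumUpTo n (λ m → φ m * forests n (m + k))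

forests-vanish : ∀ {n k} → n < k → forests n k ≡ 0
forests-vanish {zero}  {suc k} _         = refl
forests-vanish {suc n} {suc k} (s≤s n<k) = sumUpTo-zero n λ m →
  trans (cong (φ m *_) (forests-vanish (≤-trans n<k (m≤n+m k m)))) (*-zeroʳ (φ m))

θ-φ^ : ∀ n → θ (φ^ (suc n)) ≗ λ j → suc n * (θ φ ⋆ φ^ n) j
θ-φ^ zero j = begin
  θ (φ ⋆ δ₀) j                    ≡⟨ θ-⋆ φ δ₀ j ⟩
  (θ φ ⋆ δ₀) j + (φ ⋆ θ δ₀) j
    ≡⟨ cong ((θ φ ⋆ δ₀) j +_) (trans (⋆-cong (λ _ → refl) θδ₀≗0 j) (⋆-zeroʳ φ j)) ⟩
  (θ φ ⋆ δ₀) j + 0                ≡⟨ +-identityʳ _ ⟩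
  (θ φ ⋆ δ₀) j                    ≡⟨ sym (*-identityˡ _) ⟩
  1 * (θ φ ⋆ δ₀) j                ∎
  where
  open ≡-Reasoning
  θδ₀≗0 : θ δ₀ ≗ const 0
  θδ₀≗0 zero    = refl
  θδ₀≗0 (suc k) = *-zeroʳ k
θ-φ^ (suc n) j = begin
  θ (φ ⋆ φ^ (suc n)) j                                  ≡⟨ θ-⋆ φ (φ^ (suc n)) j ⟩
  (θ φ ⋆ φ^ (suc n)) j + (φ ⋆ θ (φ^ (suc n))) j         ≡⟨ cong (D +_) (⋆-cong (λ _ → refl) (θ-φ^ n) j) ⟩
  (θ φ ⋆ φ^ (suc n)) j + (φ ⋆ (λ k → suc n * (θ φ ⋆ φ^ n) k)) j
    ≡⟨ cong (D +_) (*-distribʳ-⋆ (suc n) φ _ j) ⟩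
  (θ φ ⋆ φ^ (suc n)) j + suc n * (φ ⋆ (θ φ ⋆ φ^ n)) j   ≡⟨ cong (λ x → D + suc n * x) (⋆-exchange φ (θ φ) (φ^ n) j) ⟩
  (θ φ ⋆ φ^ (suc n)) j + suc n * (θ φ ⋆ φ^ (suc n)) j   ∎
  where
  open ≡-Reasoning
  D : ℕ
  D = (θ φ ⋆ φ^ (suc n)) j

hitting-time-algebra : ∀ {J k N F P Q} .{{_ : NonZero N}} → J + k ≡ N →
                       N * F ≡ k * P + Q → J * P ≡ suc N * Q → suc N * F ≡ suc k * P
hitting-time-algebra {J} {k} {F = F} {P} {Q} refl NF≡ JP≡ = *-cancelˡ-≡ _ _ (J + k) (begin
  (J + k) * (suc (J + k) * F)             ≡⟨ *-left-comm (J + k) (suc (J + k)) F ⟩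
  suc (J + k) * ((J + k) * F)             ≡⟨ cong (suc (J + k) *_) NF≡ ⟩
  suc (J + k) * (k * P + Q)               ≡⟨ *-distribˡ-+ (suc (J + k)) (k * P) Q ⟩
  suc (J + k) * (k * P) + suc (J + k) * Q ≡⟨ cong (suc (J + k) * (k * P) +_) (sym JP≡) ⟩
  suc (J + k) * (k * P) + J * P           ≡⟨ collect J k P ⟩
  (J + k) * (suc k * P)                   ∎)
  where
  open ≡-Reasoning
  collect : ∀ J k P → suc (J + k) * (k * P) + J * P ≡ (J + k) * (suc k * P)
  collect = solve-∀

⋆-shiftedˡ : ∀ k f g → (λ m → (m + k) * f m) ⋆ g ≗ λ n → k * (f ⋆ g) n + (θ f ⋆ g) n
⋆-shiftedˡ k f g n = begin
  ((λ m → (m + k) * f m) ⋆ g) n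
    ≡⟨ ⋆-cong (λ m → trans (*-distribʳ-+ (f m) m k) (+-comm (θ f m) (k * f m))) (λ _ → refl) n ⟩
  ((λ m → k * f m + θ f m) ⋆ g) n        ≡⟨ ⋆-distribʳ-+ _ (θ f) g n ⟩
  ((λ m → k * f m) ⋆ g) n + (θ f ⋆ g) n  ≡⟨ cong (_+ (θ f ⋆ g) n) (*-distribˡ-⋆ k f g n) ⟩
  k * (f ⋆ g) n + (θ f ⋆ g) n            ∎
  where open ≡-Reasoning

hitting-time : ∀ n k → k ≤ suc n → suc n * forests (suc n) k ≡ k * φ^ (suc n) (suc n ∸ k)
hitting-time zero    zero          _        = refl
hitting-time zero    (suc zero)    _        = refl
hitting-time zero    (suc (suc k)) (s≤s ())
hitting-time (suc n) zero          _        = *-zeroʳ (suc (suc n))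
hitting-time (suc n) (suc k)       (s≤s k≤N) =
  hitting-time-algebra {j} {k} {N} {forests (suc N) (suc k)} (m∸n+n≡m k≤N) scaled-recursion (θ-φ^ N j)
  where
  open ≡-Reasoning
  N j : ℕ
  N = suc n
  j = N ∸ k
  beyond-j : ∀ m → j < m → N * (φ m * forests N (m + k)) ≡ 0
  beyond-j m j<m = begin
    N * (φ m * forests N (m + k)) ≡⟨ cong (λ x → N * (φ m * x)) (forests-vanish N<m+k) ⟩
    N * (φ m * 0)                 ≡⟨ cong (N *_) (*-zeroʳ (φ m)) ⟩
    N * 0                         ≡⟨ *-zeroʳ N ⟩
    0                             ∎
    where
    N<m+k : N < m + k
    N<m+k = subst (_< m + k) (m∸n+n≡m k≤N) (+-monoˡ-< k j<m)
  up-to-j : ∀ m → m ≤ j → N * (φ m * forests N (m + k)) ≡ (m + k) * φ m * φ^ N (j ∸ m)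
  up-to-j m m≤j = begin
    N * (φ m * forests N (m + k))          ≡⟨ *-left-comm N (φ m) _ ⟩
    φ m * (N * forests N (m + k))          ≡⟨ cong (φ m *_) (hitting-time n (m + k) m+k≤N) ⟩
    φ m * ((m + k) * φ^ N (N ∸ (m + k)))   ≡⟨ cong (λ i → φ m * ((m + k) * φ^ N i)) index ⟩
    φ m * ((m + k) * φ^ N (j ∸ m))         ≡⟨ trans (*-left-comm (φ m) (m + k) _) (sym (*-assoc (m + k) (φ m) _)) ⟩
    (m + k) * φ m * φ^ N (j ∸ m)           ∎
    where
    m+k≤N : m + k ≤ N
    m+k≤N = subst (m + k ≤_) (m∸n+n≡m k≤N) (+-monoˡ-≤ k m≤j)
    index : N ∸ (m + k) ≡ j ∸ m
    index = trans (cong (N ∸_) (+-comm m k)) (sym (∸-+-assoc N k m))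
  scaled-recursion : N * forests (suc N) (suc k) ≡ k * φ^ (suc N) j + (θ φ ⋆ φ^ N) j
  scaled-recursion = begin
    N * sumUpTo N (λ m → φ m * forests N (m + k))      ≡⟨ *-distribˡ-sumUpTo N N (λ m → φ m * forests N (m + k)) ⟩
    sumUpTo N (λ m → N * (φ m * forests N (m + k)))
      ≡⟨ sumUpTo-truncate (λ m → N * (φ m * forests N (m + k))) (m∸n≤m N k) beyond-j ⟩
    sumUpTo j (λ m → N * (φ m * forests N (m + k)))    ≡⟨ sumUpTo-cong j up-to-j ⟩
    sumUpTo j (λ m → (m + k) * φ m * φ^ N (j ∸ m))     ≡⟨ sym (⋆-sumUpTo (λ m → (m + k) * φ m) (φ^ N) j) ⟩
    ((λ m → (m + k) * φ m) ⋆ φ^ N) j                   ≡⟨ ⋆-shiftedˡ k φ (φ^ N) j ⟩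
    k * φ^ (suc N) j + (θ φ ⋆ φ^ N) j                  ∎

ψ^ : ℕ → ℕ → ℕ
ψ^ zero    = δ₀
ψ^ (suc i) = id ⋆ ψ^ i

φ-⋆ : ∀ g → φ ⋆ g ≗ λ j → g j + (id ⋆ g) j
φ-⋆ g j = begin
  (φ ⋆ g) j                       ≡⟨ ⋆-cong φ≗δ₀+id (λ _ → refl) j ⟩
  ((λ m → δ₀ m + m) ⋆ g) j        ≡⟨ ⋆-distribʳ-+ δ₀ id g j ⟩
  (δ₀ ⋆ g) j + (id ⋆ g) j         ≡⟨ cong (_+ (id ⋆ g) j) (⋆-identityˡ g j) ⟩
  g j + (id ⋆ g) j                ∎
  where
  open ≡-Reasoning
  φ≗δ₀+id : φ ≗ λ m → δ₀ m + m
  φ≗δ₀+id zero    = refl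
  φ≗δ₀+id (suc m) = refl

φ^-binomial : ∀ {n M} → n ≤ M → φ^ n ≗ λ j → sumUpTo M (λ i → (n C i) * ψ^ i j)
φ^-binomial {zero} {M} _ j = sym (trans (sumUpTo-truncate {0} {M} _ z≤n higher-terms) (*-identityˡ (δ₀ j)))
  where
  higher-terms : ∀ i → 0 < i → (0 C i) * ψ^ i j ≡ 0
  higher-terms (suc i) _ = cong (_* ψ^ (suc i) j) (k>n⇒nCk≡0 {0} {suc i} (s≤s z≤n))
φ^-binomial {suc n} {suc M} (s≤s n≤M) j = begin
  (φ ⋆ φ^ n) j                                                    ≡⟨ φ-⋆ (φ^ n) j ⟩
  φ^ n j + (id ⋆ φ^ n) j                                          ≡⟨ cong₂ _+_ (φ^-binomial (m≤n⇒m≤1+n n≤M) j) shifted ⟩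
  1 * δ₀ j + sumUpTo M (λ i → (n C suc i) * ψ^ (suc i) j) + sumUpTo M (λ i → (n C i) * ψ^ (suc i) j)
    ≡⟨ +-assoc (1 * δ₀ j) _ _ ⟩
  1 * δ₀ j + (sumUpTo M (λ i → (n C suc i) * ψ^ (suc i) j) + sumUpTo M (λ i → (n C i) * ψ^ (suc i) j))
    ≡⟨ cong (1 * δ₀ j +_) (sym (sumUpTo-distrib-+ M _ _)) ⟩
  1 * δ₀ j + sumUpTo M (λ i → (n C suc i) * ψ^ (suc i) j + (n C i) * ψ^ (suc i) j)
    ≡⟨ cong (1 * δ₀ j +_) (sumUpTo-cong M (λ i _ → pascal i)) ⟩
  1 * δ₀ j + sumUpTo M (λ i → (suc n C suc i) * ψ^ (suc i) j)     ∎
  where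
  open ≡-Reasoning
  pascal : ∀ i → (n C suc i) * ψ^ (suc i) j + (n C i) * ψ^ (suc i) j ≡ (suc n C suc i) * ψ^ (suc i) j
  pascal i = trans (sym (*-distribʳ-+ (ψ^ (suc i) j) (n C suc i) (n C i)))
                   (cong (_* ψ^ (suc i) j) (trans (+-comm (n C suc i) (n C i)) (nCk+nC[k+1]≡[n+1]C[k+1] n i)))
  shifted : (id ⋆ φ^ n) j ≡ sumUpTo M (λ i → (n C i) * ψ^ (suc i) j)
  shifted = begin
    (id ⋆ φ^ n) j                                              ≡⟨ ⋆-cong (λ _ → refl) (φ^-binomial n≤M) j ⟩
    (id ⋆ (λ j → sumUpTo M (λ i → (n C i) * ψ^ i j))) j        ≡⟨ ⋆-sumUpToʳ M id (λ i j → (n C i) * ψ^ i j) j ⟩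
    sumUpTo M (λ i → (id ⋆ (λ j → (n C i) * ψ^ i j)) j)        ≡⟨ sumUpTo-cong M (λ i _ → *-distribʳ-⋆ (n C i) id (ψ^ i) j) ⟩
    sumUpTo M (λ i → (n C i) * ψ^ (suc i) j)                   ∎

hockey-stick : ∀ {a b} → a ≤ b → ∀ j → (const 1 ⋆ λ t → (t + a) C suc b) j ≡ (j + suc a) C suc (suc b)
hockey-stick {a} {b} a≤b zero    =
  trans (+-identityʳ (a C suc b)) (trans (k>n⇒nCk≡0 (s≤s a≤b)) (sym (k>n⇒nCk≡0 (s≤s (s≤s a≤b)))))
hockey-stick {a} {b} a≤b (suc j) = begin
  1 * ((suc j + a) C suc b) + (const 1 ⋆ λ t → (t + a) C suc b) j
    ≡⟨ cong₂ _+_ (trans (*-identityˡ _) (cong (_C suc b) (sym (+-suc j a)))) (hockey-stick a≤b j) ⟩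
  (j + suc a) C suc b + (j + suc a) C suc (suc b)                  ≡⟨ nCk+nC[k+1]≡[n+1]C[k+1] (j + suc a) (suc b) ⟩
  (suc j + suc a) C suc (suc b)                                    ∎
  where open ≡-Reasoning

id-⋆-binomial : ∀ {a b} → a ≤ b → ∀ j → (id ⋆ λ t → (t + a) C suc b) j ≡ (j + suc a) C suc (suc (suc b))
id-⋆-binomial {a} {b} a≤b zero    = sym (k>n⇒nCk≡0 (s≤s (s≤s (m≤n⇒m≤1+n a≤b))))
id-⋆-binomial {a} {b} a≤b (suc j) = begin
  (suc ⋆ X) j                                                  ≡⟨ ⋆-distribʳ-+ (const 1) id X j ⟩
  (const 1 ⋆ X) j + (id ⋆ X) j                                 ≡⟨ cong₂ _+_ (hockey-stick a≤b j) (id-⋆-binomial a≤b j) ⟩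
  (j + suc a) C suc (suc b) + (j + suc a) C suc (suc (suc b))  ≡⟨ nCk+nC[k+1]≡[n+1]C[k+1] (j + suc a) (suc (suc b)) ⟩
  (suc j + suc a) C suc (suc (suc b))                          ∎
  where
  open ≡-Reasoning
  X : ℕ → ℕ
  X t = (t + a) C suc b

ψ^-coefficient : ∀ i j → ψ^ (suc i) j ≡ (j + i) C suc (i + i)
ψ^-coefficient zero    j = begin
  (id ⋆ δ₀) j      ≡⟨ ⋆-comm id δ₀ j ⟩
  (δ₀ ⋆ id) j      ≡⟨ ⋆-identityˡ id j ⟩
  j                ≡⟨ sym (trans (cong (_C 1) (+-identityʳ j)) (nC1≡n j)) ⟩
  (j + 0) C 1      ∎
  where open ≡-Reasoning
ψ^-coefficient (suc i) j = begin
  (id ⋆ ψ^ (suc i)) j                                ≡⟨ ⋆-cong (λ _ → refl) (ψ^-coefficient i) j ⟩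
  (id ⋆ λ t → (t + i) C suc (i + i)) j               ≡⟨ id-⋆-binomial (m≤m+n i i) j ⟩
  (j + suc i) C suc (suc (suc (i + i)))              ≡⟨ cong (λ m → (j + suc i) C suc (suc m)) (sym (+-suc i i)) ⟩
  (j + suc i) C suc (suc i + suc i)                  ∎
  where open ≡-Reasoning

ψ^-vanish : ∀ {i j} → j < i → ψ^ i j ≡ 0
ψ^-vanish {suc i} {j} (s≤s j≤i) = trans (ψ^-coefficient i j) (k>n⇒nCk≡0 (s≤s (+-monoˡ-≤ i j≤i)))

C-symmetric : ∀ a b → (a + b) C a ≡ (a + b) C b
C-symmetric a b = trans (nCk≡nC[n∸k] (m≤m+n a b)) (cong ((a + b) C_) (m+n∸m≡n a b))

formula-term : ∀ i k → (suc (i + k) C i) * ψ^ i (i + k) ≡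
                       (suc (i + k) C suc k) * ((2 * suc (i + k) ∸ 2 ∸ suc k) C k)
formula-term zero    k = begin
  1 * δ₀ k                                          ≡⟨ *-identityˡ (δ₀ k) ⟩
  δ₀ k                                              ≡⟨ sym (top k) ⟩
  (2 * suc k ∸ 2 ∸ suc k) C k                       ≡⟨ sym (*-identityˡ _) ⟩
  1 * ((2 * suc k ∸ 2 ∸ suc k) C k)                 ≡⟨ cong (_* ((2 * suc k ∸ 2 ∸ suc k) C k)) (sym (nCn≡1 (suc k))) ⟩
  (suc k C suc k) * ((2 * suc k ∸ 2 ∸ suc k) C k)   ∎
  where
  open ≡-Reasoning
  double : ∀ k → 2 * suc (suc k) ≡ 2 + (suc (suc k) + k)
  double = solve-∀
  top : ∀ k → (2 * suc k ∸ 2 ∸ suc k) C k ≡ δ₀ k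
  top zero    = refl
  top (suc k) = begin
    (2 * suc (suc k) ∸ 2 ∸ suc (suc k)) C suc k        ≡⟨ cong (λ m → (m ∸ 2 ∸ suc (suc k)) C suc k) (double k) ⟩
    (2 + (suc (suc k) + k) ∸ 2 ∸ suc (suc k)) C suc k  ≡⟨ cong (λ m → (m ∸ suc (suc k)) C suc k) (m+n∸m≡n 2 (suc (suc k) + k)) ⟩
    (suc (suc k) + k ∸ suc (suc k)) C suc k            ≡⟨ cong (_C suc k) (m+n∸m≡n (suc (suc k)) k) ⟩
    k C suc k                                          ≡⟨ k>n⇒nCk≡0 (n<1+n k) ⟩
    0                                                  ∎
formula-term (suc d) k = begin
  (suc n C suc d) * ψ^ (suc d) n                  ≡⟨ cong₂ _*_ outer (ψ^-coefficient d n) ⟩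
  (suc n C suc k) * ((n + d) C suc (d + d))        ≡⟨ cong ((suc n C suc k) *_) inner ⟩
  (suc n C suc k) * ((n + d) C k)                  ≡⟨ cong (λ m → (suc n C suc k) * (m C k)) (sym top-index) ⟩
  (suc n C suc k) * ((2 * suc n ∸ 2 ∸ suc k) C k)  ∎
  where
  open ≡-Reasoning
  n : ℕ
  n = suc (d + k)
  split-outer : ∀ d k → suc (suc (d + k)) ≡ suc d + suc k
  split-outer = solve-∀
  split-inner : ∀ d k → suc (d + k) + d ≡ suc (d + d) + k
  split-inner = solve-∀
  split-top : ∀ d k → 2 * suc (suc (d + k)) ≡ 2 + (suc k + (suc (d + k) + d))
  split-top = solve-∀
  outer : suc n C suc d ≡ suc n C suc k
  outer = subst (λ m → m C suc d ≡ m C suc k) (sym (split-outer d k)) (C-symmetric (suc d) (suc k))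
  inner : (n + d) C suc (d + d) ≡ (n + d) C k
  inner = subst (λ m → m C suc (d + d) ≡ m C k) (sym (split-inner d k)) (C-symmetric (suc (d + d)) k)
  top-index : 2 * suc n ∸ 2 ∸ suc k ≡ n + d
  top-index = begin
    2 * suc n ∸ 2 ∸ suc k                   ≡⟨ cong (λ m → m ∸ 2 ∸ suc k) (split-top d k) ⟩
    2 + (suc k + (n + d)) ∸ 2 ∸ suc k       ≡⟨ cong (_∸ suc k) (m+n∸m≡n 2 (suc k + (n + d))) ⟩
    suc k + (n + d) ∸ suc k                 ≡⟨ m+n∸m≡n (suc k) (n + d) ⟩
    n + d                                   ∎

sum1to-sumUpTo : ∀ n (g : ℕ → ℕ) → sum1to (suc n) g ≡ sumUpTo n (g ∘ suc)
sum1to-sumUpTo zero    g = refl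
sum1to-sumUpTo (suc n) g = trans (cong (_+ g (suc (suc n))) (sum1to-sumUpTo n g)) (sym (sumUpTo-suc n (g ∘ suc)))

-- Reversal matches the i-th term of the binomial sum with the k-th term of formulaSum,
-- i + k = n + 1.
φ^-diagonal : ∀ n → φ^ (suc n) n ≡ formulaSum (suc n)
φ^-diagonal n = begin
  φ^ (suc n) n                              ≡⟨ φ^-binomial {suc n} ≤-refl n ⟩
  sumUpTo (suc n) F                         ≡⟨ sumUpTo-reverse (suc n) F ⟩
  F (suc n) + sumUpTo n (λ k → F (n ∸ k))   ≡⟨ cong (_+ sumUpTo n (λ k → F (n ∸ k))) top-vanishes ⟩
  sumUpTo n (λ k → F (n ∸ k))               ≡⟨ sumUpTo-cong n reindex ⟩
  sumUpTo n (g ∘ suc)                       ≡⟨ sym (sum1to-sumUpTo n g) ⟩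
  formulaSum (suc n)                        ∎
  where
  open ≡-Reasoning
  F : ℕ → ℕ
  F i = (suc n C i) * ψ^ i n
  g : ℕ → ℕ
  g k = (suc n C k) * ((2 * suc n ∸ 2 ∸ k) C (k ∸ 1))
  top-vanishes : F (suc n) ≡ 0
  top-vanishes = trans (cong ((suc n C suc n) *_) (ψ^-vanish (n<1+n n))) (*-zeroʳ (suc n C suc n))
  reindex : ∀ k → k ≤ n → F (n ∸ k) ≡ g (suc k)
  reindex k k≤n = subst (λ m → (suc m C (n ∸ k)) * ψ^ (n ∸ k) m ≡ (suc m C suc k) * ((2 * suc m ∸ 2 ∸ suc k) C k))
                        (m∸n+n≡m k≤n) (formula-term (n ∸ k) k)

trees-formula : ∀ n → suc n * forests (suc n) 1 ≡ formulaSum (suc n)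
trees-formula n = trans (hitting-time n 1 (s≤s z≤n)) (trans (*-identityˡ _) (φ^-diagonal n))

Counts : (ℕ → ℕ) → (ℕ → Set) → Set
Counts p P = ∀ n → P n ↔ Fin (p n)

↔Fin-unique : ∀ {A : Set} {m n} → A ↔ Fin m → A ↔ Fin n → m ≡ n
↔Fin-unique A↔m A↔n = ↔⇒≡ (↔-trans (↔-sym A↔m) A↔n)

⊎-↔Fin : ∀ {A B : Set} {m n} → A ↔ Fin m → B ↔ Fin n → (A ⊎ B) ↔ Fin (m + n)
⊎-↔Fin {m = m} A↔m B↔n = ↔-trans (⊎-cong A↔m B↔n) (↔-sym (+↔⊎ {m}))

×-↔Fin : ∀ {A B : Set} {m n} → A ↔ Fin m → B ↔ Fin n → (A × B) ↔ Fin (m * n)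
×-↔Fin {m = m} A↔m B↔n = ↔-trans (×-cong A↔m B↔n) (↔-sym (*↔× {m}))

¬-↔Fin0 : ∀ {A : Set} → ¬ A → A ↔ Fin 0
¬-↔Fin0 ¬A = mk↔ₛ′ (⊥-elim ∘ ¬A) (λ ()) (λ ()) (⊥-elim ∘ ¬A)

Σℕ-↔ : (B : ℕ → Set) → Σ ℕ B ↔ (B 0 ⊎ Σ ℕ (B ∘ suc))
Σℕ-↔ B = mk↔ₛ′ to from (λ { (inj₁ _) → refl ; (inj₂ _) → refl }) (λ { (zero , _) → refl ; (suc _ , _) → refl })
  where
  to : Σ ℕ B → B 0 ⊎ Σ ℕ (B ∘ suc)
  to (zero  , b) = inj₁ b
  to (suc m , b) = inj₂ (m , b)
  from : B 0 ⊎ Σ ℕ (B ∘ suc) → Σ ℕ B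
  from (inj₁ b)       = 0 , b
  from (inj₂ (m , b)) = suc m , b

Σℕ-↔Fin : ∀ n {B : ℕ → Set} {b : ℕ → ℕ} → (∀ m → B m ↔ Fin (b m)) → (∀ m → n < m → ¬ B m) →
          Σ ℕ B ↔ Fin (sumUpTo n b)
Σℕ-↔Fin zero    {B} {b} B↔b empty = subst (λ k → Σ ℕ B ↔ Fin k) (+-identityʳ (b 0))
  (↔-trans (Σℕ-↔ B) (⊎-↔Fin (B↔b 0) (¬-↔Fin0 λ { (m , x) → empty (suc m) (s≤s z≤n) x })))
Σℕ-↔Fin (suc n) {B} B↔b empty =
  ↔-trans (Σℕ-↔ B) (⊎-↔Fin (B↔b 0) (Σℕ-↔Fin n (B↔b ∘ suc) (λ m n<m → empty (suc m) (s≤s n<m))))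

infixl 7 _⊗_

_⊗_ : (ℕ → Set) → (ℕ → Set) → ℕ → Set
(P ⊗ Q) n = Σ ℕ λ i → Σ ℕ λ j → i + j ≡ n × P i × Q j

⊗-zero-↔ : ∀ P Q → (P ⊗ Q) 0 ↔ (P 0 × Q 0)
⊗-zero-↔ P Q = mk↔ₛ′ to (λ (p , q) → 0 , 0 , refl , p , q) (λ _ → refl) λ { (zero , zero , refl , _) → refl }
  where
  to : (P ⊗ Q) 0 → P 0 × Q 0
  to (zero , zero , refl , p , q) = p , q

⊗-suc-↔ : ∀ P Q n → (P ⊗ Q) (suc n) ↔ ((P 0 × Q (suc n)) ⊎ (P ∘ suc ⊗ Q) n)
⊗-suc-↔ P Q n = mk↔ₛ′ to from
  (λ { (inj₁ _) → refl ; (inj₂ (_ , _ , refl , _)) → refl })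
  (λ { (zero , _ , refl , _) → refl ; (suc _ , _ , refl , _) → refl })
  where
  to : (P ⊗ Q) (suc n) → (P 0 × Q (suc n)) ⊎ (P ∘ suc ⊗ Q) n
  to (zero  , j , refl , p , q) = inj₁ (p , q)
  to (suc i , j , refl , p , q) = inj₂ (i , j , refl , p , q)
  from : (P 0 × Q (suc n)) ⊎ (P ∘ suc ⊗ Q) n → (P ⊗ Q) (suc n)
  from (inj₁ (p , q))             = 0 , suc n , refl , p , q
  from (inj₂ (i , j , eq , p , q)) = suc i , j , cong suc eq , p , q

⊗-counts : ∀ {p q P Q} → Counts p P → Counts q Q → Counts (p ⋆ q) (P ⊗ Q)
⊗-counts {P = P} {Q} P↔p Q↔q zero    = ↔-trans (⊗-zero-↔ P Q) (×-↔Fin (P↔p 0) (Q↔q 0))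
⊗-counts {P = P} {Q} P↔p Q↔q (suc n) = ↔-trans (⊗-suc-↔ P Q n)
  (⊎-↔Fin (×-↔Fin (P↔p 0) (Q↔q (suc n))) (⊗-counts (P↔p ∘ suc) Q↔q n))

Sized : (X : Set) → (X → ℕ) → ℕ → Set
Sized X s n = Σ X λ x → s x ≡ n

sized-≡ : ∀ {X : Set} {s : X → ℕ} {n} {x y : X} {e : s x ≡ n} {e′ : s y ≡ n} →
          x ≡ y → _≡_ {A = Sized X s n} (x , e) (y , e′)
sized-≡ refl = cong (_ ,_) (≡-irrelevant _ _)

sized-↔ : ∀ {X Y : Set} {sX : X → ℕ} {sY : Y → ℕ} (e : X ↔ Y) →
          (∀ x → sY (Inverse.to e x) ≡ sX x) → ∀ n → Sized X sX n ↔ Sized Y sY n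
sized-↔ {sX = sX} {sY} e size-to n = mk↔ₛ′
  (λ (x , eq) → to x , trans (size-to x) eq)
  (λ (y , eq) → from y , trans (sym (size-to (from y))) (trans (cong sY (strictlyInverseˡ y)) eq))
  (λ (y , _) → sized-≡ (strictlyInverseˡ y))
  (λ (x , _) → sized-≡ (strictlyInverseʳ x))
  where open Inverse e

Forest : ℕ → ℕ → Set
Forest n k = Sized (Vec DTree k) sizes n

length≤sizes : ∀ {k} (ts : Vec DTree k) → k ≤ sizes ts
length≤sizes []                   = z≤n
length≤sizes (node _ cs _ ∷ ts) = s≤s (≤-trans (length≤sizes ts) (m≤n+m (sizes ts) (sizes cs)))

Forest-empty : ∀ {n k} → n < k → ¬ Forest n k
Forest-empty n<k (ts , refl) = <⇒≱ n<k (length≤sizes ts)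

sizes-++ : ∀ {m k} (xs : Vec DTree m) (ys : Vec DTree k) → sizes (xs ++ ys) ≡ sizes xs + sizes ys
sizes-++ []       ys = refl
sizes-++ (x ∷ xs) ys = trans (cong (size x +_) (sizes-++ xs ys)) (sym (+-assoc (size x) _ _))

Choice-↔Fin : ∀ m → Choice m ↔ Fin (φ m)
Choice-↔Fin zero    = ↔-sym 1↔⊤
Choice-↔Fin (suc m) = ↔-refl

Forest-suc-↔ : ∀ n k → Forest (suc n) (suc k) ↔ Σ ℕ (λ m → Choice m × Forest n (m + k))
Forest-suc-↔ n k = mk↔ₛ′ to from to∘from from∘to
  where
  to : Forest (suc n) (suc k) → Σ ℕ (λ m → Choice m × Forest n (m + k))
  to (node m cs c ∷ ts , eq) = m , c , cs ++ ts , trans (sizes-++ cs ts) (suc-injective eq)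
  from : Σ ℕ (λ m → Choice m × Forest n (m + k)) → Forest (suc n) (suc k)
  from (m , c , ts , eq) = node m (take m ts) c ∷ drop m ts ,
    cong suc (trans (sym (sizes-++ (take m ts) (drop m ts))) (trans (cong sizes (take++drop≡id m ts)) eq))
  to∘from : ∀ y → to (from y) ≡ y
  to∘from (m , c , ts , _) = cong (λ v → m , c , v) (sized-≡ (take++drop≡id m ts))
  from∘to : ∀ x → from (to x) ≡ x
  from∘to (node m cs c ∷ ts , _) = sized-≡ (cong₂ (λ xs ys → node m xs c ∷ ys)
    (++-injectiveˡ (take m (cs ++ ts)) cs split) (++-injectiveʳ (take m (cs ++ ts)) cs split))
    where
    split : take m (cs ++ ts) ++ drop m (cs ++ ts) ≡ cs ++ ts
    split = take++drop≡id m (cs ++ ts)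

forests-counts : ∀ k → Counts (λ n → forests n k) (λ n → Forest n k)
forests-counts zero    zero    =
  mk↔ₛ′ (λ _ → Fin.zero) (λ _ → [] , refl) (λ { Fin.zero → refl ; (Fin.suc ()) }) (λ { ([] , refl) → refl })
forests-counts (suc k) zero    = ¬-↔Fin0 (Forest-empty (s≤s z≤n))
forests-counts zero    (suc n) = ¬-↔Fin0 λ { ([] , ()) }
forests-counts (suc k) (suc n) = ↔-trans (Forest-suc-↔ n k) (Σℕ-↔Fin n
  (λ m → ×-↔Fin (Choice-↔Fin m) (forests-counts (m + k) n))
  (λ m n<m (_ , forest) → Forest-empty (≤-trans n<m (m≤m+n m k)) forest))

Pointed : Set → Set
Pointed A = Σ ℕ λ m → Fin (suc m) × Vec A (suc m)

Zipper : Set → Set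
Zipper A = Σ ℕ λ p → Σ ℕ λ q → Vec A p × A × Vec A q

module _ {A : Set} where

  consᵖ : A → Pointed A → Pointed A
  consᵖ x (m , i , v) = suc m , Fin.suc i , x ∷ v

  consᶻ : A → Zipper A → Zipper A
  consᶻ x (p , q , ls , d , rs) = suc p , q , x ∷ ls , d , rs

  unzip : Pointed A → Zipper A
  unzip (m     , Fin.zero  , x ∷ v) = 0 , m , [] , x , v
  unzip (suc m , Fin.suc i , x ∷ v) = consᶻ x (unzip (m , i , v))

  zip : Zipper A → Pointed A
  zip (p , q , ls , d , rs) = p + q , fromℕ p ↑ˡ q , (ls ∷ʳ d) ++ rs

  zip-consᶻ : ∀ x z → zip (consᶻ x z) ≡ consᵖ x (zip z)
  zip-consᶻ x (p , q , ls , d , rs) = refl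

  zip∘unzip : ∀ x → zip (unzip x) ≡ x
  zip∘unzip (m     , Fin.zero  , x ∷ v) = refl
  zip∘unzip (suc m , Fin.suc i , x ∷ v) = trans (zip-consᶻ x (unzip (m , i , v)))
    (cong (consᵖ x) (zip∘unzip (m , i , v)))

  unzip∘zip : ∀ z → unzip (zip z) ≡ z
  unzip∘zip (zero  , q , []     , d , rs) = refl
  unzip∘zip (suc p , q , x ∷ ls , d , rs) = cong (consᶻ x) (unzip∘zip (p , q , ls , d , rs))

  Pointed↔Zipper : Pointed A ↔ Zipper A
  Pointed↔Zipper = mk↔ₛ′ unzip zip unzip∘zip zip∘unzip

pointedSize : Pointed DTree → ℕ
pointedSize (_ , _ , v) = sizes v

zipperSize : Zipper DTree → ℕ
zipperSize (_ , _ , ls , d , rs) = size d + (sizes ls + sizes rs)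

zipperSize-unzip : ∀ x → zipperSize (unzip x) ≡ pointedSize x
zipperSize-unzip (m     , Fin.zero  , x ∷ v) = refl
zipperSize-unzip (suc m , Fin.suc i , x ∷ v) = trans (consᶻ-size (unzip (m , i , v)))
  (cong (size x +_) (zipperSize-unzip (m , i , v)))
  where
  consᶻ-size : ∀ z → zipperSize (consᶻ x z) ≡ size x + zipperSize z
  consᶻ-size (_ , _ , ls , d , rs) = regroup (size x) (size d) (sizes ls) (sizes rs)
    where
    regroup : ∀ a b c e → b + (a + c + e) ≡ a + (b + (c + e))
    regroup = solve-∀

Forests : ℕ → Set
Forests n = Σ ℕ (Forest n)

allForests : ℕ → ℕ
allForests n = sumUpTo n (forests n)

Forests-counts : Counts allForests Forests
Forests-counts n = Σℕ-↔Fin n (λ k → forests-counts k n) (λ k n<k → Forest-empty n<k)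

Tree↔Forest1 : ∀ n → TreesOfSize n ↔ Forest n 1
Tree↔Forest1 = sized-↔ (mk↔ₛ′ (_∷ []) (λ { (t ∷ []) → t }) (λ { (t ∷ []) → refl }) (λ _ → refl))
                       (λ t → +-identityʳ (size t))

trees-counts : Counts (λ n → forests n 1) TreesOfSize
trees-counts n = ↔-trans (Tree↔Forest1 n) (forests-counts 1 n)

Forests-suc-↔ : ∀ n → Forests (suc n) ↔ (TreesOfSize ⊗ Forests) (suc n)
Forests-suc-↔ n = mk↔ₛ′ to from
  (λ { (_ , _ , _ , (_ , refl) , (_ , _ , refl)) → refl })
  (λ { (suc _ , _ ∷ _ , _) → refl })
  where
  to : Forests (suc n) → (TreesOfSize ⊗ Forests) (suc n)
  to (suc k , t ∷ ts , eq) = size t , sizes ts , eq , (t , refl) , (k , ts , refl)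
  from : (TreesOfSize ⊗ Forests) (suc n) → Forests (suc n)
  from (_ , _ , eq , (t , refl) , (k , ts , refl)) = suc k , t ∷ ts , eq

Tree-suc-↔ : ∀ n → TreesOfSize (suc n) ↔ (Forest n 0 ⊎ Sized (Pointed DTree) pointedSize n)
Tree-suc-↔ n = mk↔ₛ′ to from
  (λ { (inj₁ ([] , _)) → cong inj₁ (sized-≡ refl) ; (inj₂ _) → cong inj₂ (sized-≡ refl) })
  (λ { (node zero [] _ , _) → sized-≡ refl ; (node (suc _) _ _ , _) → sized-≡ refl })
  where
  to : TreesOfSize (suc n) → Forest n 0 ⊎ Sized (Pointed DTree) pointedSize n
  to (node zero    []  _ , eq) = inj₁ ([] , suc-injective eq)
  to (node (suc m) ts  c , eq) = inj₂ ((m , c , ts) , suc-injective eq)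
  from : Forest n 0 ⊎ Sized (Pointed DTree) pointedSize n → TreesOfSize (suc n)
  from (inj₁ ([] , eq))          = node 0 [] tt , cong suc eq
  from (inj₂ ((m , c , ts) , eq)) = node (suc m) ts c , cong suc eq

Zipper-↔ : ∀ n → Sized (Zipper DTree) zipperSize n ↔ (TreesOfSize ⊗ (Forests ⊗ Forests)) n
Zipper-↔ n = mk↔ₛ′ to from
  (λ { (_ , _ , _ , (_ , refl) , (_ , _ , refl , (_ , _ , refl) , (_ , _ , refl))) → refl })
  (λ _ → refl)
  where
  to : Sized (Zipper DTree) zipperSize n → (TreesOfSize ⊗ (Forests ⊗ Forests)) n
  to ((p , q , ls , d , rs) , eq) =
    size d , sizes ls + sizes rs , eq , (d , refl) , (sizes ls , sizes rs , refl , (p , ls , refl) , (q , rs , refl))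
  from : (TreesOfSize ⊗ (Forests ⊗ Forests)) n → Sized (Zipper DTree) zipperSize n
  from (_ , _ , eq , (d , refl) , (_ , _ , refl , (p , ls , refl) , (q , rs , refl))) = (p , q , ls , d , rs) , eq

forests-zero : ∀ n → forests n 0 ≡ δ₀ n
forests-zero zero    = refl
forests-zero (suc n) = refl

Tree-suc-decomposition : ∀ n → TreesOfSize (suc n) ↔ (Forest n 0 ⊎ (TreesOfSize ⊗ (Forests ⊗ Forests)) n)
Tree-suc-decomposition n = ↔-trans (Tree-suc-↔ n)
  (⊎-cong ↔-refl (↔-trans (sized-↔ Pointed↔Zipper zipperSize-unzip n) (Zipper-↔ n)))

module _ {a : ℕ → ℕ} (a-counts : Counts a TreesOfSize) where

  a≗forests1 : ∀ n → a n ≡ forests n 1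
  a≗forests1 n = ↔Fin-unique (a-counts n) (trees-counts n)

  allForests-recursion : allForests ≗ λ n → δ₀ n + (a ⋆ allForests) n
  allForests-recursion zero    = cong (λ x → 1 + x * 1) (sym (a≗forests1 0))
  allForests-recursion (suc n) = ↔Fin-unique (Forests-counts (suc n))
    (↔-trans (Forests-suc-↔ n) (⊗-counts a-counts Forests-counts (suc n)))

  trees-recursion : ∀ n → a (suc n) ≡ δ₀ n + (a ⋆ (allForests ⋆ allForests)) n
  trees-recursion n = trans
    (↔Fin-unique (a-counts (suc n)) (↔-trans (Tree-suc-decomposition n)
      (⊎-↔Fin (forests-counts 0 n) (⊗-counts a-counts (⊗-counts Forests-counts Forests-counts) n))))
    (cong (_+ (a ⋆ (allForests ⋆ allForests)) n) (forests-zero n))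

open import Data.Integer as ℤ using (ℤ; +_)
import Data.Integer.Properties as ℤ
open import Data.Integer.Tactic.RingSolver using () renaming (solve-∀ to solveℤ-∀)

ι : (ℕ → ℕ) → FPS
ι f n = + f n

sumℤ-cong : ∀ n {f g : ℕ → ℤ} → (∀ k → k ≤ n → f k ≡ g k) → sumℤ n f ≡ sumℤ n g
sumℤ-cong zero    f≡g = f≡g 0 z≤n
sumℤ-cong (suc n) f≡g = cong₂ ℤ._+_ (sumℤ-cong n (λ k k≤n → f≡g k (m≤n⇒m≤1+n k≤n))) (f≡g (suc n) ≤-refl)

sumℤ-ι : ∀ n f → sumℤ n (ι f) ≡ + sumUpTo n f
sumℤ-ι zero    f = refl
sumℤ-ι (suc n) f = begin
  sumℤ n (ι f) ℤ.+ + f (suc n)      ≡⟨ cong (ℤ._+ + f (suc n)) (sumℤ-ι n f) ⟩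
  + sumUpTo n f ℤ.+ + f (suc n)     ≡⟨ sym (ℤ.pos-+ (sumUpTo n f) (f (suc n))) ⟩
  + (sumUpTo n f + f (suc n))       ≡⟨ cong +_ (sym (sumUpTo-suc n f)) ⟩
  + sumUpTo (suc n) f               ∎
  where open ≡-Reasoning

sumℤ-distrib-- : ∀ n (f g : ℕ → ℤ) → sumℤ n (λ k → f k ℤ.- g k) ≡ sumℤ n f ℤ.- sumℤ n g
sumℤ-distrib-- zero    f g = refl
sumℤ-distrib-- (suc n) f g = trans (cong (ℤ._+ (f (suc n) ℤ.- g (suc n))) (sumℤ-distrib-- n f g))
  (interchange (sumℤ n f) (sumℤ n g) (f (suc n)) (g (suc n)))
  where
  interchange : ∀ a b c d → a ℤ.- b ℤ.+ (c ℤ.- d) ≡ a ℤ.+ c ℤ.- (b ℤ.+ d)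
  interchange = solveℤ-∀

⊛-cong : ∀ {f f′ g g′} → f ≋ f′ → g ≋ g′ → f ⊛ g ≋ f′ ⊛ g′
⊛-cong f≋f′ g≋g′ n = sumℤ-cong n (λ k _ → cong₂ ℤ._*_ (f≋f′ k) (g≋g′ (n ∸ k)))

ι-⋆ : ∀ f g → ι f ⊛ ι g ≋ ι (f ⋆ g)
ι-⋆ f g n = begin
  sumℤ n (λ k → + f k ℤ.* + g (n ∸ k))   ≡⟨ sumℤ-cong n (λ k _ → sym (ℤ.pos-* (f k) (g (n ∸ k)))) ⟩
  sumℤ n (ι (λ k → f k * g (n ∸ k)))     ≡⟨ sumℤ-ι n _ ⟩
  + sumUpTo n (λ k → f k * g (n ∸ k))    ≡⟨ cong +_ (sym (⋆-sumUpTo f g n)) ⟩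
  + (f ⋆ g) n                            ∎
  where open ≡-Reasoning

𝟙≋ιδ₀ : 𝟙 ≋ ι δ₀
𝟙≋ιδ₀ zero    = refl
𝟙≋ιδ₀ (suc n) = refl

⊛-identityʳ : ∀ G → G ⊛ 𝟙 ≋ G
⊛-identityʳ G zero    = ℤ.*-identityʳ (G 0)
⊛-identityʳ G (suc n) = begin
  sumℤ n (λ k → G k ℤ.* 𝟙 (suc n ∸ k)) ℤ.+ G (suc n) ℤ.* 𝟙 (n ∸ n)
    ≡⟨ cong₂ ℤ._+_ (trans (sumℤ-cong n below-top) (sumℤ-ι n (λ _ → 0))) top ⟩
  + sumUpTo n (λ _ → 0) ℤ.+ G (suc n)  ≡⟨ cong (λ s → + s ℤ.+ G (suc n)) (sumUpTo-zero n (λ _ → refl)) ⟩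
  + 0 ℤ.+ G (suc n)                    ≡⟨ ℤ.+-identityˡ (G (suc n)) ⟩
  G (suc n)                            ∎
  where
  open ≡-Reasoning
  below-top : ∀ k → k ≤ n → G k ℤ.* 𝟙 (suc n ∸ k) ≡ + 0
  below-top k k≤n = trans (cong (λ i → G k ℤ.* 𝟙 i) (+-∸-assoc 1 k≤n)) (ℤ.*-zeroʳ (G k))
  top : G (suc n) ℤ.* 𝟙 (n ∸ n) ≡ G (suc n)
  top = trans (cong (λ i → G (suc n) ℤ.* 𝟙 i) (n∸n≡0 n)) (ℤ.*-identityʳ (G (suc n)))

⊛-distribˡ-⊖ : ∀ F G H → F ⊛ (G ⊖ H) ≋ F ⊛ G ⊖ F ⊛ H
⊛-distribˡ-⊖ F G H n = trans (sumℤ-cong n (λ k _ → distrib (F k) (G (n ∸ k)) (H (n ∸ k)))) (sumℤ-distrib-- n _ _)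
  where
  distrib : ∀ a b c → a ℤ.* (b ℤ.- c) ≡ a ℤ.* b ℤ.- a ℤ.* c
  distrib = solveℤ-∀

inverse-fixpoint : ∀ {G A} → G ⊛ (𝟙 ⊖ A) ≋ 𝟙 → G ≋ 𝟙 ⊕ G ⊛ A
inverse-fixpoint {G} {A} inverse n = begin
  G n                                       ≡⟨ sym (⊛-identityʳ G n) ⟩
  (G ⊛ 𝟙) n                                 ≡⟨ add-back ((G ⊛ 𝟙) n) ((G ⊛ A) n) ⟩
  (G ⊛ 𝟙) n ℤ.- (G ⊛ A) n ℤ.+ (G ⊛ A) n     ≡⟨ cong (ℤ._+ (G ⊛ A) n) (sym (⊛-distribˡ-⊖ G 𝟙 A n)) ⟩
  (G ⊛ (𝟙 ⊖ A)) n ℤ.+ (G ⊛ A) n             ≡⟨ cong (ℤ._+ (G ⊛ A) n) (inverse n) ⟩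
  𝟙 n ℤ.+ (G ⊛ A) n                         ∎
  where
  open ≡-Reasoning
  add-back : ∀ x y → x ≡ x ℤ.- y ℤ.+ y
  add-back = solveℤ-∀

⊛-causal : ∀ {G H A} n → A 0 ≡ + 0 → (∀ {k} → k < n → G k ≡ H k) → (G ⊛ A) n ≡ (H ⊛ A) n
⊛-causal {G} {H} {A} zero    A₀≡0 _   = trans (times-A₀ G 0) (sym (times-A₀ H 0))
  where
  times-A₀ : ∀ F k → F k ℤ.* A 0 ≡ + 0
  times-A₀ F k = trans (cong (F k ℤ.*_) A₀≡0) (ℤ.*-zeroʳ (F k))
⊛-causal {G} {H} {A} (suc n) A₀≡0 G≡H =
  cong₂ ℤ._+_ (sumℤ-cong n (λ k k≤n → cong (ℤ._* A (suc n ∸ k)) (G≡H (s≤s k≤n)))) (trans (top G) (sym (top H)))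
  where
  top : ∀ F → F (suc n) ℤ.* A (n ∸ n) ≡ + 0
  top F = trans (cong (λ i → F (suc n) ℤ.* A i) (n∸n≡0 n)) (trans (cong (F (suc n) ℤ.*_) A₀≡0) (ℤ.*-zeroʳ (F (suc n))))

fixpoint-unique : ∀ {G H A} → A 0 ≡ + 0 → G ≋ 𝟙 ⊕ G ⊛ A → H ≋ 𝟙 ⊕ H ⊛ A → G ≋ H
fixpoint-unique {G} {H} {A} A₀≡0 G-fix H-fix = <-rec (λ n → G n ≡ H n) λ n G≡H-below →
  trans (G-fix n) (trans (cong (λ x → 𝟙 n ℤ.+ x) (⊛-causal {G} {H} {A} n A₀≡0 G≡H-below)) (sym (H-fix n)))

z·_ : (ℕ → ℕ) → ℕ → ℕ
(z· f) zero    = 0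
(z· f) (suc n) = f n

z·-cong : ∀ {f g} → f ≗ g → z· f ≗ z· g
z·-cong f≗g zero    = refl
z·-cong f≗g (suc n) = f≗g n

z·-⋆ : ∀ f g → (z· f) ⋆ g ≗ z· (f ⋆ g)
z·-⋆ f g zero    = refl
z·-⋆ f g (suc n) = refl

𝕫≋ιz·δ₀ : 𝕫 ≋ ι (z· δ₀)
𝕫≋ιz·δ₀ zero          = refl
𝕫≋ιz·δ₀ (suc zero)    = refl
𝕫≋ιz·δ₀ (suc (suc n)) = refl

genFun≋ι : ∀ {a} → a 0 ≡ 0 → genFun a ≋ ι a
genFun≋ι a₀≡0 zero    = cong +_ (sym a₀≡0)
genFun≋ι a₀≡0 (suc n) = refl

inverse-≋ι : ∀ {a f : ℕ → ℕ} {G} → a 0 ≡ 0 → f ≗ (λ n → δ₀ n + (a ⋆ f) n) →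
             G ⊛ (𝟙 ⊖ genFun a) ≋ 𝟙 → G ≋ ι f
inverse-≋ι {a} {f} {G} a₀≡0 f-rec inverse =
  fixpoint-unique {G} {ι f} {genFun a} refl (inverse-fixpoint {G} {genFun a} inverse) ιf-fixpoint
  where
  open ≡-Reasoning
  ιf-fixpoint : ι f ≋ 𝟙 ⊕ ι f ⊛ genFun a
  ιf-fixpoint n = begin
    + f n                     ≡⟨ cong +_ (f-rec n) ⟩
    + (δ₀ n + (a ⋆ f) n)      ≡⟨ ℤ.pos-+ (δ₀ n) _ ⟩
    + δ₀ n ℤ.+ + (a ⋆ f) n    ≡⟨ cong₂ ℤ._+_ (sym (𝟙≋ιδ₀ n)) (cong +_ (⋆-comm a f n)) ⟩
    𝟙 n ℤ.+ + (f ⋆ a) n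
      ≡⟨ cong (λ x → 𝟙 n ℤ.+ x) (sym (trans (⊛-cong {ι f} (λ _ → refl) (genFun≋ι a₀≡0) n) (ι-⋆ f a n))) ⟩
    𝟙 n ℤ.+ (ι f ⊛ genFun a) n ∎

functional-equation : ∀ {a f : ℕ → ℕ} → a 0 ≡ 0 →
  f ≗ (λ n → δ₀ n + (a ⋆ f) n) → (∀ n → a (suc n) ≡ δ₀ n + (a ⋆ (f ⋆ f)) n) →
  (G : FPS) → G ⊛ (𝟙 ⊖ genFun a) ≋ 𝟙 → genFun a ≋ 𝕫 ⊕ 𝕫 ⊛ genFun a ⊛ (G ⊛ G)
functional-equation {a} {f} a₀≡0 f-rec a-rec G inverse = equation
  where
  open ≡-Reasoning
  G≋ιf : G ≋ ι f
  G≋ιf = inverse-≋ι {G = G} a₀≡0 f-rec inverse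
  product : 𝕫 ⊛ genFun a ⊛ (G ⊛ G) ≋ ι (z· (a ⋆ (f ⋆ f)))
  product n = begin
    (𝕫 ⊛ genFun a ⊛ (G ⊛ G)) n            ≡⟨ ⊛-cong (⊛-cong 𝕫≋ιz·δ₀ (genFun≋ι a₀≡0)) (⊛-cong G≋ιf G≋ιf) n ⟩
    (ι (z· δ₀) ⊛ ι a ⊛ (ι f ⊛ ι f)) n     ≡⟨ ⊛-cong (ι-⋆ (z· δ₀) a) (ι-⋆ f f) n ⟩
    (ι (z· δ₀ ⋆ a) ⊛ ι (f ⋆ f)) n         ≡⟨ ι-⋆ (z· δ₀ ⋆ a) (f ⋆ f) n ⟩
    + (z· δ₀ ⋆ a ⋆ (f ⋆ f)) n             ≡⟨ cong +_ (⋆-cong (z·-⋆ δ₀ a) (λ _ → refl) n) ⟩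
    + (z· (δ₀ ⋆ a) ⋆ (f ⋆ f)) n           ≡⟨ cong +_ (z·-⋆ (δ₀ ⋆ a) (f ⋆ f) n) ⟩
    + (z· (δ₀ ⋆ a ⋆ (f ⋆ f))) n           ≡⟨ cong +_ (z·-cong (⋆-cong (⋆-identityˡ a) (λ _ → refl)) n) ⟩
    + (z· (a ⋆ (f ⋆ f))) n                ∎
  equation : genFun a ≋ 𝕫 ⊕ 𝕫 ⊛ genFun a ⊛ (G ⊛ G)
  equation zero    = sym (cong (λ x → + 0 ℤ.+ x) (product zero))
  equation (suc n) = begin
    + a (suc n)                             ≡⟨ cong +_ (a-rec n) ⟩
    + (δ₀ n + (a ⋆ (f ⋆ f)) n)              ≡⟨ ℤ.pos-+ (δ₀ n) _ ⟩
    + δ₀ n ℤ.+ + (a ⋆ (f ⋆ f)) n            ≡⟨ sym (cong₂ ℤ._+_ (𝕫≋ιz·δ₀ (suc n)) (product (suc n))) ⟩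
    𝕫 (suc n) ℤ.+ (𝕫 ⊛ genFun a ⊛ (G ⊛ G)) (suc n) ∎

mainTheorem2 : (a : ℕ → ℕ) → (∀ n → TreesOfSize n ↔ Fin (a n)) →
    ((G : FPS) → G ⊛ (𝟙 ⊖ genFun a) ≋ 𝟙 →
      genFun a ≋ 𝕫 ⊕ 𝕫 ⊛ genFun a ⊛ (G ⊛ G))
    × (∀ n → 1 ≤ n → n * a n ≡ formulaSum n)
mainTheorem2 a a-counts =
  functional-equation (a≗forests1 a-counts 0) (allForests-recursion a-counts) (trees-recursion a-counts) ,
  counting-formula
  where
  counting-formula : ∀ n → 1 ≤ n → n * a n ≡ formulaSum n
  counting-formula (suc n) _ = trans (cong (suc n *_) (a≗forests1 a-counts (suc n))) (trees-formula n)
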